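{- Let $n\ge1$ and let $A_0,A_1$ be the $(n+1)\times(n+1)$ matrices with $A_1=I+E_{1,n+1}$ and $A_0=\sum_{i=1}^{n}E_{i+1,i}+E_{1,n+1}+E_{n+1,n+1}$ (so $(v_1,\dots,v_{n+1})A_0=(v_2,\dots,v_{n+1},v_1+v_{n+1})$ and $(v_1,\dots,v_{n+1})A_1=(v_1,\dots,v_n,v_1+v_{n+1})$). For $(\sigma,\tau_0,\tau_1)\in S_{n+1}^3$ let $M_0=P_\sigma A_0P_{\tau_0}$, $M_1=P_\sigma A_1P_{\tau_1}$; the multidimensional continued fraction algorithm on the $n$-dimensional simplex generated by the triple is determined by $(M_0,M_1)$. Then the number of distinct algorithms obtained this way (as $(\sigma,\tau_0,\tau_1)$ ranges over $S_{n+1}^3$) is at most $(n+1)!^3\,\frac{1}{(n-1)!}$.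
   Context: $E_{i,j}$ denotes the matrix unit. A permutation $\rho\in S_{n+1}$ is identified with the (column) permutation matrix $P_\rho$ having $(P_\rho)_{i,\rho(i)}=1$ and other entries $0$. Two triples are regarded as generating the same algorithm when they yield the same pair $(M_0,M_1)$. -}

module Defs where

open import Data.Nat using (ℕ; zero; suc; _+_; _*_; _≡ᵇ_)
open import Data.Bool using (if_then_else_)
open import Data.Fin using (Fin; toℕ) renaming (zero to fz; suc to fs)
open import Data.Fin.Permutation using (Permutation′; _⟨$⟩ʳ_)
open import Data.Product using (_×_; _,_)
open import Relation.Binary.PropositionalEquality using (_≡_)

Mat : ℕ → Set
Mat m = Fin m → Fin m → ℕ

δ : ℕ → ℕ → ℕ
δ a b = if a ≡ᵇ b then 1 else 0

sumF : ∀ {m} → (Fin m → ℕ) → ℕ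
sumF {zero} f = 0
sumF {suc m} f = f fz + sumF (λ i → f (fs i))

_⊗_ : ∀ {m} → Mat m → Mat m → Mat m
(A ⊗ B) i k = sumF (λ j → A i j * B j k)

P : ∀ {m} → Permutation′ m → Mat m
P ρ i j = δ (toℕ (ρ ⟨$⟩ʳ i)) (toℕ j)

-- paper index i (1-based) corresponds to Fin index i-1; so n+1 ↦ toℕ = n
-- A₁ = I + E_{1,n+1}
A₁ : (n : ℕ) → Mat (suc n)
A₁ n i j = δ (toℕ i) (toℕ j) + δ (toℕ i) 0 * δ (toℕ j) n

A₀ : (n : ℕ) → Mat (suc n)
A₀ n i j = δ (toℕ i) (suc (toℕ j))
         + δ (toℕ i) 0 * δ (toℕ j) n
         + δ (toℕ i) n * δ (toℕ j) n

algPair : (n : ℕ) → Permutation′ (suc n) → Permutation′ (suc n) → Permutation′ (suc n)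
        → Mat (suc n) × Mat (suc n)
algPair n σ τ₀ τ₁ = ((P σ ⊗ A₀ n) ⊗ P τ₀) , ((P σ ⊗ A₁ n) ⊗ P τ₁)

_≈M_ : ∀ {m} → Mat m → Mat m → Set
A ≈M B = ∀ i j → A i j ≡ B i j

_≈P_ : ∀ {m} → Mat m × Mat m → Mat m × Mat m → Set
(A , B) ≈P (C , D) = (A ≈M C) × (B ≈M D)

{-# OPTIONS --safe #-}
module Submission where

-- A₀ is the permutation matrix of the cyclic shift plus one matrix unit, A₁ the identity plus
-- one matrix unit. Conjugating by permutation matrices, M₀ and M₁ are the permutation matrices of
-- g₀ = τ₀ ∘ shift ∘ σ and g₁ = τ₁ ∘ σ, each plus a single matrix unit whose row is σ⁻¹(n+1)
-- resp. σ⁻¹(1) and whose column is then forced by g₀ resp. g₁. So (M₀, M₁) is determined by two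
-- permutations and an ordered pair of distinct indices: (n+1)!² (n+1) n = (n+1)!³ / (n-1)!
-- possibilities.

open import Defs
open import Data.Nat using (ℕ; zero; suc; _+_; _*_; _∸_; _^_; _≤_; _!)
open import Data.Nat.Properties using (+-identityʳ; *-comm; ≤-reflexive)
open import Data.Fin using (Fin; toℕ; fromℕ; inject₁; punchIn; punchOut; remQuot; combine)
  renaming (zero to fz; suc to fs)
open import Data.Fin.Properties
  using (toℕ-injective; toℕ-fromℕ; toℕ-inject₁; fromℕ≢inject₁; inject₁-injective; suc-injective; 0≢1+n;
         remQuot-combine; punchOut-injective; punchIn-punchOut)
  renaming (_≟_ to _≟ᶠ_)
open import Data.Fin.Permutation using (Permutation′; _⟨$⟩ʳ_; _⟨$⟩ˡ_; inverseʳ; inverseˡ)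
open import Data.Product using (Σ; ∃; _×_; _,_; proj₁; proj₂)
open import Data.Empty using (⊥-elim)
open import Function using (_∘_; id)
open import Function.Definitions using (Injective)
open import Relation.Binary.PropositionalEquality
open import Relation.Nullary using (yes; no)
open import Data.Nat.Solver using (module +-*-Solver)

δ-refl : ∀ a → δ a a ≡ 1
δ-refl zero    = refl
δ-refl (suc a) = δ-refl a

δ-≢ : ∀ a b → a ≢ b → δ a b ≡ 0
δ-≢ zero    zero    a≢b = ⊥-elim (a≢b refl)
δ-≢ zero    (suc b) _   = refl
δ-≢ (suc a) zero    _   = refl
δ-≢ (suc a) (suc b) a≢b = δ-≢ a b (a≢b ∘ cong suc)

δ-sym : ∀ a b → δ a b ≡ δ b a
δ-sym zero    zero    = refl
δ-sym zero    (suc b) = refl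
δ-sym (suc a) zero    = refl
δ-sym (suc a) (suc b) = δ-sym a b

δF : ∀ {m} → Fin m → Fin m → ℕ
δF x y = δ (toℕ x) (toℕ y)

δF-sym : ∀ {m} (x y : Fin m) → δF x y ≡ δF y x
δF-sym x y = δ-sym (toℕ x) (toℕ y)

δF-resp-⇔ : ∀ {m m′} {x y : Fin m} {x′ y′ : Fin m′} →
  (x ≡ y → x′ ≡ y′) → (x′ ≡ y′ → x ≡ y) → δF x y ≡ δF x′ y′
δF-resp-⇔ {x = x} {y} {x′} {y′} to from with x ≟ᶠ y
... | yes refl rewrite to refl = trans (δ-refl (toℕ x)) (sym (δ-refl (toℕ y′)))
... | no x≢y = trans (δ-≢ _ _ (x≢y ∘ toℕ-injective))
                     (sym (δ-≢ _ _ (x≢y ∘ from ∘ toℕ-injective)))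

sumF-cong : ∀ {m} {f g : Fin m → ℕ} → f ≗ g → sumF f ≡ sumF g
sumF-cong {zero}  f≗g = refl
sumF-cong {suc m} f≗g = cong₂ _+_ (f≗g fz) (sumF-cong (f≗g ∘ fs))

sumF-zero : ∀ {m} → sumF {m} (λ _ → 0) ≡ 0
sumF-zero {zero}  = refl
sumF-zero {suc m} = sumF-zero {m}

sumF-δˡ : ∀ {m} (p : Fin m) (h : Fin m → ℕ) → sumF (λ j → δF p j * h j) ≡ h p
sumF-δˡ {suc m} fz     h = begin
  h fz + 0 + sumF {m} (λ _ → 0) ≡⟨ cong (h fz + 0 +_) (sumF-zero {m}) ⟩
  h fz + 0 + 0                  ≡⟨ trans (+-identityʳ _) (+-identityʳ _) ⟩
  h fz                          ∎
  where open ≡-Reasoning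
sumF-δˡ {suc m} (fs p) h = sumF-δˡ p (h ∘ fs)

sumF-δʳ : ∀ {m} (p : Fin m) (h : Fin m → ℕ) → sumF (λ j → h j * δF j p) ≡ h p
sumF-δʳ p h = trans (sumF-cong λ j → trans (*-comm (h j) _) (cong (_* h j) (δF-sym j p)))
                    (sumF-δˡ p h)

module _ {m : ℕ} (π : Permutation′ m) where

  ⟨$⟩ʳ-injective : Injective _≡_ _≡_ (π ⟨$⟩ʳ_)
  ⟨$⟩ʳ-injective {x} {y} πx≡πy = trans (sym (inverseˡ π)) (trans (cong (π ⟨$⟩ˡ_) πx≡πy) (inverseˡ π))

  ⟨$⟩ˡ-injective : Injective _≡_ _≡_ (π ⟨$⟩ˡ_)
  ⟨$⟩ˡ-injective {x} {y} πx≡πy = trans (sym (inverseʳ π)) (trans (cong (π ⟨$⟩ʳ_) πx≡πy) (inverseʳ π))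

  δF-⟨$⟩ʳ : ∀ x k → δF (π ⟨$⟩ʳ x) k ≡ δF x (π ⟨$⟩ˡ k)
  δF-⟨$⟩ʳ x k = δF-resp-⇔ (λ e → trans (sym (inverseˡ π)) (cong (π ⟨$⟩ˡ_) e))
                           (λ e → trans (cong (π ⟨$⟩ʳ_) e) (inverseʳ π))

P-⊗-P : ∀ {m} (σ τ : Permutation′ m) (A : Mat m) i k →
  ((P σ ⊗ A) ⊗ P τ) i k ≡ A (σ ⟨$⟩ʳ i) (τ ⟨$⟩ˡ k)
P-⊗-P σ τ A i k = begin
  sumF (λ j → sumF (λ l → P σ i l * A l j) * P τ j k)
    ≡⟨ sumF-cong (λ j → cong₂ _*_ (sumF-δˡ (σ ⟨$⟩ʳ i) (λ l → A l j)) (δF-⟨$⟩ʳ τ j k)) ⟩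
  sumF (λ j → A (σ ⟨$⟩ʳ i) j * δF j (τ ⟨$⟩ˡ k))
    ≡⟨ sumF-δʳ (τ ⟨$⟩ˡ k) (A (σ ⟨$⟩ʳ i)) ⟩
  A (σ ⟨$⟩ʳ i) (τ ⟨$⟩ˡ k) ∎
  where open ≡-Reasoning

perturbed : ∀ {m} → (Fin m → Fin m) → Fin m → Fin m → Mat m
perturbed g a b i k = δF (g i) k + δF i a * δF (g b) k

perturbed-cong : ∀ {m} {g h : Fin m → Fin m} (a b : Fin m) → g ≗ h →
  perturbed g a b ≈M perturbed h a b
perturbed-cong a b g≗h i k =
  cong₂ (λ x y → δF x k + δF i a * δF y k) (g≗h i) (g≗h b)

P-⊗-perturbed-⊗-P : ∀ {m} (σ τ : Permutation′ m) (A : Mat m) (h : Fin m → Fin m) (p q b : Fin m) →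
  (∀ x y → A x y ≡ δF (h x) y + δF x p * δF y q) → h (σ ⟨$⟩ʳ b) ≡ q →
  ((P σ ⊗ A) ⊗ P τ) ≈M perturbed (λ i → τ ⟨$⟩ʳ h (σ ⟨$⟩ʳ i)) (σ ⟨$⟩ˡ p) b
P-⊗-perturbed-⊗-P σ τ A h p q b A≡ hσb≡q i k = begin
  ((P σ ⊗ A) ⊗ P τ) i k
    ≡⟨ P-⊗-P σ τ A i k ⟩
  A (σ ⟨$⟩ʳ i) (τ ⟨$⟩ˡ k)
    ≡⟨ A≡ (σ ⟨$⟩ʳ i) (τ ⟨$⟩ˡ k) ⟩
  δF (h (σ ⟨$⟩ʳ i)) (τ ⟨$⟩ˡ k) + δF (σ ⟨$⟩ʳ i) p * δF (τ ⟨$⟩ˡ k) q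
    ≡⟨ cong₂ _+_ (sym (δF-⟨$⟩ʳ τ _ k)) (cong₂ _*_ (δF-⟨$⟩ʳ σ i p) last-factor) ⟩
  perturbed (λ i → τ ⟨$⟩ʳ h (σ ⟨$⟩ʳ i)) (σ ⟨$⟩ˡ p) b i k ∎
  where
  open ≡-Reasoning
  last-factor : δF (τ ⟨$⟩ˡ k) q ≡ δF (τ ⟨$⟩ʳ h (σ ⟨$⟩ʳ b)) k
  last-factor = begin
    δF (τ ⟨$⟩ˡ k) q            ≡⟨ δF-sym (τ ⟨$⟩ˡ k) q ⟩
    δF q (τ ⟨$⟩ˡ k)            ≡⟨ δF-⟨$⟩ʳ τ q k ⟨
    δF (τ ⟨$⟩ʳ q) k            ≡⟨ cong (λ x → δF (τ ⟨$⟩ʳ x) k) hσb≡q ⟨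
    δF (τ ⟨$⟩ʳ h (σ ⟨$⟩ʳ b)) k ∎

-- x ↦ x - 1 modulo n + 1: the matrix units E_{x, shift x} form the cyclic part of A₀.
shift : ∀ {n} → Fin (suc n) → Fin (suc n)
shift {n} fz = fromℕ n
shift (fs j) = inject₁ j

shift-injective : ∀ {n} → Injective _≡_ _≡_ (shift {n})
shift-injective {x = fz}   {fz}   _  = refl
shift-injective {x = fz}   {fs y} eq = ⊥-elim (fromℕ≢inject₁ eq)
shift-injective {x = fs x} {fz}   eq = ⊥-elim (fromℕ≢inject₁ (sym eq))
shift-injective {x = fs x} {fs y} eq = cong fs (inject₁-injective eq)

δF-shift : ∀ {n} (x y : Fin (suc n)) →
  δF (shift x) y ≡ δ (toℕ x) (suc (toℕ y)) + δ (toℕ x) 0 * δ (toℕ y) n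
δF-shift {n} fz y rewrite toℕ-fromℕ n = trans (δ-sym n (toℕ y)) (sym (+-identityʳ _))
δF-shift (fs x) y rewrite toℕ-inject₁ x = sym (+-identityʳ _)

A₀-perturbed : ∀ n x y → A₀ n x y ≡ δF (shift x) y + δF x (fromℕ n) * δF y (fromℕ n)
A₀-perturbed n x y rewrite toℕ-fromℕ n = cong (_+ δ (toℕ x) n * δ (toℕ y) n) (sym (δF-shift x y))

A₁-perturbed : ∀ n x y → A₁ n x y ≡ δF (id x) y + δF x fz * δF y (fromℕ n)
A₁-perturbed n x y rewrite toℕ-fromℕ n = refl

normalForm : ∀ {m} → ((Fin m → Fin m) × (Fin m → Fin m)) × (Fin m × Fin m) → Mat m × Mat m
normalForm ((g₀ , g₁) , (a′ , a)) = perturbed g₀ a′ a , perturbed g₁ a a′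

≈P-trans : ∀ {m} {X Y Z : Mat m × Mat m} → X ≈P Y → Y ≈P Z → X ≈P Z
≈P-trans (A≈B , C≈D) (B≈E , D≈F) =
  (λ i j → trans (A≈B i j) (B≈E i j)) , (λ i j → trans (C≈D i j) (D≈F i j))

≈P-reflexive : ∀ {m} {X Y : Mat m × Mat m} → X ≡ Y → X ≈P Y
≈P-reflexive refl = (λ _ _ → refl) , (λ _ _ → refl)

normalForm-cong : ∀ {m} {g₀ g₁ h₀ h₁ : Fin m → Fin m} (a′ a : Fin m) → g₀ ≗ h₀ → g₁ ≗ h₁ →
  normalForm ((g₀ , g₁) , (a′ , a)) ≈P normalForm ((h₀ , h₁) , (a′ , a))
normalForm-cong a′ a g₀≗h₀ g₁≗h₁ = perturbed-cong a′ a g₀≗h₀ , perturbed-cong a a′ g₁≗h₁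

algPair-normalForm : ∀ n (σ τ₀ τ₁ : Permutation′ (suc n)) →
  algPair n σ τ₀ τ₁ ≈P normalForm (((λ i → τ₀ ⟨$⟩ʳ shift (σ ⟨$⟩ʳ i)) , (λ i → τ₁ ⟨$⟩ʳ (σ ⟨$⟩ʳ i))) ,
                                   (σ ⟨$⟩ˡ fromℕ n , σ ⟨$⟩ˡ fz))
algPair-normalForm n σ τ₀ τ₁ =
  P-⊗-perturbed-⊗-P σ τ₀ (A₀ n) shift (fromℕ n) (fromℕ n) (σ ⟨$⟩ˡ fz)
    (A₀-perturbed n) (cong shift (inverseʳ σ)) ,
  P-⊗-perturbed-⊗-P σ τ₁ (A₁ n) id fz (fromℕ n) (σ ⟨$⟩ˡ fromℕ n)
    (A₁-perturbed n) (inverseʳ σ)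

pairing : ∀ {a b} {A : Set a} {B : Set b} {k l} → (Fin k → A) → (Fin l → B) → Fin (k * l) → A × B
pairing {l = l} f g x = let (i , j) = remQuot l x in f i , g j

pairing-combine : ∀ {a b} {A : Set a} {B : Set b} {k l} (f : Fin k → A) (g : Fin l → B) i j →
  pairing f g (combine i j) ≡ (f i , g j)
pairing-combine {l = l} f g i j = cong (λ (i , j) → f i , g j) (remQuot-combine {k = l} i j)

-- Mixed-radix code: the image of 0, then a code for the rest of the map with that image punched out.
selfInjections : ∀ m → Fin (m !) → Fin m → Fin m
selfInjections (suc m) c fz     = proj₁ (remQuot (m !) c)
selfInjections (suc m) c (fs i) = let (j , c′) = remQuot (m !) c in punchIn j (selfInjections m c′ i)

selfInjections-complete : ∀ m (g : Fin m → Fin m) → Injective _≡_ _≡_ g →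
  ∃ λ c → selfInjections m c ≗ g
selfInjections-complete zero    g _     = fz , λ ()
selfInjections-complete (suc m) g g-inj = combine (g fz) c′ , complete
  where
  g0≢gs : ∀ i → g fz ≢ g (fs i)
  g0≢gs i eq with g-inj eq
  ... | ()
  g′ : Fin m → Fin m
  g′ i = punchOut (g0≢gs i)
  g′-inj : Injective _≡_ _≡_ g′
  g′-inj {x} {y} eq = suc-injective (g-inj (punchOut-injective (g0≢gs x) (g0≢gs y) eq))
  c′ = proj₁ (selfInjections-complete m g′ g′-inj)
  complete : selfInjections (suc m) (combine (g fz) c′) ≗ g
  complete fz     = cong proj₁ (remQuot-combine {k = m !} (g fz) c′)
  complete (fs i) = begin
    selfInjections (suc m) (combine (g fz) c′) (fs i)
      ≡⟨ cong (λ (j , c) → punchIn j (selfInjections m c i)) (remQuot-combine {k = m !} (g fz) c′) ⟩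
    punchIn (g fz) (selfInjections m c′ i)
      ≡⟨ cong (punchIn (g fz)) (proj₂ (selfInjections-complete m g′ g′-inj) i) ⟩
    punchIn (g fz) (g′ i)
      ≡⟨ punchIn-punchOut (g0≢gs i) ⟩
    g (fs i) ∎
    where open ≡-Reasoning

distinctPairs : ∀ {n} → Fin (suc n * n) → Fin (suc n) × Fin (suc n)
distinctPairs {n} x = let (a , c) = remQuot n x in a , punchIn a c

distinctPairs-complete : ∀ {n} {a b : Fin (suc n)} → a ≢ b → ∃ λ x → distinctPairs x ≡ (a , b)
distinctPairs-complete {n} {a} {b} a≢b = combine a (punchOut a≢b) , (begin
  distinctPairs (combine a (punchOut a≢b))
    ≡⟨ cong (λ (a , c) → a , punchIn a c) (remQuot-combine {k = n} a _) ⟩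
  (a , punchIn a (punchOut a≢b))
    ≡⟨ cong (a ,_) (punchIn-punchOut a≢b) ⟩
  (a , b) ∎)
  where open ≡-Reasoning

algorithmCount : ℕ → ℕ
algorithmCount n = ((suc n) ! * (suc n) !) * (suc n * n)

algorithmCount-bound : ∀ n → algorithmCount (suc n) * (n !) ≡ (suc (suc n) !) ^ 3
algorithmCount-bound n =
  solve 3 (λ m k f → ((m :* (k :* f)) :* (m :* (k :* f))) :* (m :* k) :* f
                   := (m :* (k :* f)) :* ((m :* (k :* f)) :* ((m :* (k :* f)) :* con 1)))
        refl (suc (suc n)) (suc n) (n !)
  where open +-*-Solver

selfInjectionPairs : ∀ m → Fin (m ! * m !) → (Fin m → Fin m) × (Fin m → Fin m)
selfInjectionPairs m = pairing (selfInjections m) (selfInjections m)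

enumerateNormalForms : ∀ n → Fin (algorithmCount n) → Mat (suc n) × Mat (suc n)
enumerateNormalForms n =
  normalForm ∘ pairing (selfInjectionPairs (suc n)) distinctPairs

enumerateNormalForms-complete : ∀ n {g₀ g₁ : Fin (suc n) → Fin (suc n)} {a′ a : Fin (suc n)} →
  Injective _≡_ _≡_ g₀ → Injective _≡_ _≡_ g₁ → a′ ≢ a →
  ∃ λ i → normalForm ((g₀ , g₁) , (a′ , a)) ≈P enumerateNormalForms n i
enumerateNormalForms-complete n {a′ = a′} {a} g₀-inj g₁-inj a′≢a =
  let (c₀ , c₀-codes) = selfInjections-complete (suc n) _ g₀-inj
      (c₁ , c₁-codes) = selfInjections-complete (suc n) _ g₁-inj
      (x , x-codes)   = distinctPairs-complete a′≢a
  in combine (combine c₀ c₁) x ,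
     ≈P-trans (normalForm-cong a′ a (sym ∘ c₀-codes) (sym ∘ c₁-codes))
       (≈P-reflexive (cong normalForm (sym (begin
         pairing (selfInjectionPairs (suc n)) distinctPairs (combine (combine c₀ c₁) x)
           ≡⟨ pairing-combine (selfInjectionPairs (suc n)) distinctPairs (combine c₀ c₁) x ⟩
         (selfInjectionPairs (suc n) (combine c₀ c₁) , distinctPairs x)
           ≡⟨ cong₂ _,_ (pairing-combine (selfInjections (suc n)) (selfInjections (suc n)) c₀ c₁) x-codes ⟩
         ((selfInjections (suc n) c₀ , selfInjections (suc n) c₁) , (a′ , a)) ∎))))
  where open ≡-Reasoning

mainTheorem14 : (n : ℕ) → 1 ≤ n →
    Σ ℕ λ k → (k * ((n ∸ 1) !) ≤ ((suc n) !) ^ 3) ×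
      Σ (Fin k → Mat (suc n) × Mat (suc n)) λ f →
        (σ τ₀ τ₁ : Permutation′ (suc n)) → ∃ λ i → algPair n σ τ₀ τ₁ ≈P f i
mainTheorem14 (suc n) _ =
  algorithmCount (suc n) , ≤-reflexive (algorithmCount-bound n) , enumerateNormalForms (suc n) ,
  λ σ τ₀ τ₁ →
    let (i , normalForm≈) = enumerateNormalForms-complete (suc n)
          (λ e → ⟨$⟩ʳ-injective σ (shift-injective (⟨$⟩ʳ-injective τ₀ e)))
          (λ e → ⟨$⟩ʳ-injective σ (⟨$⟩ʳ-injective τ₁ e))
          (λ e → 0≢1+n (sym (⟨$⟩ˡ-injective σ e)))
    in i , ≈P-trans (algPair-normalForm (suc n) σ τ₀ τ₁) normalForm≈
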